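{- Let $j,m$ be nonnegative integers with $m\ge2$, and let $\ell=\lceil\log_2(m+j)\rceil$. Suppose there exists a positive integer $s$ such that $\mathbf{t}_s\mathbf{t}_{s+1}=\mathbf{t}_{m+s}\mathbf{t}_{m+s+1}$. Then $$\mathfrak{K}_j(m)<2^\ell+\frac{2^\ell(s+1)-j}{m}.$$
   Context: The Thue–Morse word $\mathbf{t}=\mathbf{t}_1\mathbf{t}_2\mathbf{t}_3\cdots=0110100110010110\cdots$ is the infinite binary word whose $i$-th letter $\mathbf{t}_i$ ($i\ge 1$) is the parity of the number of 1's in the binary expansion of $i-1$. A $k$-anti-power is a word $w^{(1)}\cdots w^{(k)}$ with $w^{(1)},\dots,w^{(k)}$ pairwise distinct words of the same length. For $j\ge0$, the $j$-fix of $\mathbf{t}$ of length $N$ is $\mathbf{t}_{j+1}\cdots\mathbf{t}_{j+N}$. For a positive integer $m$, $\mathfrak{K}_j(m)$ is the smallest positive integer $k$ such that the $j$-fix of $\mathbf{t}$ of length $km$ is not a $k$-anti-power. -}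

module Defs where

open import Data.Nat using (ℕ; zero; suc; _+_; _*_; _∸_; _<_; _≤_)
open import Data.Nat.DivMod using (_/_; _%_)
open import Data.Bool using (Bool; true; false; _xor_)
open import Data.Product using (Σ; _×_; ∃-syntax)
open import Relation.Binary.PropositionalEquality using (_≡_)
open import Relation.Nullary using (¬_)

-- Parity of the number of 1's in the binary expansion of n, computed with
-- fuel (fuel ≥ n suffices since n / 2 < n for n ≥ 1; the digits of 0 add nothing).
parityFuel : ℕ → ℕ → Bool
parityFuel zero    n = false
parityFuel (suc f) zero = false
parityFuel (suc f) n@(suc _) = isOdd (n % 2) xor parityFuel f (n / 2)
  where
  isOdd : ℕ → Bool
  isOdd zero = false
  isOdd (suc _) = true

binParity : ℕ → Bool
binParity n = parityFuel n n

-- Thue–Morse word, 1-indexed: t i = parity of #1's of (i - 1), for i ≥ 1.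
-- (t 0 is a junk value and is never used.)
t : ℕ → Bool
t i = binParity (i ∸ 1)

-- In the j-fix of t of length k*m, cut into k blocks of length m,
-- the a-th and b-th blocks (0-indexed) are equal words.
-- Block a is t_{j+a*m+1} ... t_{j+a*m+m}.
BlocksEqual : (j m a b : ℕ) → Set
BlocksEqual j m a b = (r : ℕ) → r < m → t (j + a * m + r + 1) ≡ t (j + b * m + r + 1)

IsAntiPower : (j m k : ℕ) → Set
IsAntiPower j m k = (a b : ℕ) → a < b → b < k → ¬ BlocksEqual j m a b

IsK : (j m k : ℕ) → Set
IsK j m k = (1 ≤ k) × ¬ IsAntiPower j m k × ((k' : ℕ) → 1 ≤ k' → k' < k → IsAntiPower j m k')

module Submission where

-- Write τ n = t (n + 1) for the 0-indexed Thue–Morse word,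
-- so τ n is the parity of the binary digit sum of n.  For L = 2^l and r < L,
-- the binary expansion of L·c + r is that of c followed by that of r, hence
--   τ (L·c + r) = τ c xor τ r.
-- Consequently τ c = τ (c + m) forces the whole length-L block of τ starting at
-- L·c to reappear L·m positions later, and the hypothesis on s = c + 1
-- (τ c τ (c+1) = τ (c+m) τ (c+m+1)) makes the window [L·c, L·c + 2L) reappear
-- shifted by L·m.  With ℓ = ⌈log₂ (m + j)⌉ we have m + j ≤ L, so some length-m
-- block j + a·m of the j-fix fits inside this window; block a and block a + L
-- are then equal, the j-fix of length (a + L + 1)·m is not an anti-power, and
-- 𝔎_j(m) ≤ a + L + 1, which gives the bound.  The file develops: the digit
-- recursion and the concatenation identity for τ, the shift lemmas, the bound
-- n ≤ 2^⌈log₂ n⌉, the choice of the block a, decidability of anti-powers and a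
-- least-number principle yielding 𝔎_j(m), and finally the theorem.

open import Defs
open import Data.Bool using (Bool; true; false; _xor_)
open import Data.Bool.Properties using (xor-assoc; xor-comm; xor-identityʳ)
open import Data.Empty using (⊥-elim)
open import Data.Nat
open import Data.Nat.DivMod
open import Data.Nat.Logarithm using (⌈log₂_⌉)
open import Data.Nat.Logarithm.Core using (⌈log2⌉)
open import Data.Nat.Properties
open import Data.Nat.Tactic.RingSolver using (solve-∀)
open import Data.Product using (_×_; _,_; ∃-syntax)
open import Induction.WellFounded using (Acc; acc)
open import Relation.Binary.PropositionalEquality
open import Relation.Nullary using (¬_; Dec; yes; no; ¬?)
open import Relation.Nullary.Decidable using (map′; decidable-stable)
import Data.Bool.Properties as Bool

τ : ℕ → Bool
τ = binParity

τ-shifted : ∀ n → t (n + 1) ≡ τ n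
τ-shifted n = cong t (+-comm n 1)

oddB : ℕ → Bool
oddB zero    = false
oddB (suc _) = true

half≤pred : ∀ x → suc x / 2 ≤ x
half≤pred x = <⇒≤pred (m/n<m (suc x) 2 (s≤s (s≤s z≤n)))

parityFuel-step : ∀ f x →
  parityFuel (suc f) (suc x) ≡ oddB (suc x % 2) xor parityFuel f (suc x / 2)
parityFuel-step f x with suc x % 2
... | zero  = refl
... | suc _ = refl

parityFuel-irrelevant : ∀ f g n → n ≤ f → n ≤ g → parityFuel f n ≡ parityFuel g n
parityFuel-irrelevant zero    zero    zero    _         _         = refl
parityFuel-irrelevant zero    (suc g) zero    _         _         = refl
parityFuel-irrelevant (suc f) zero    zero    _         _         = refl
parityFuel-irrelevant (suc f) (suc g) zero    _         _         = refl
parityFuel-irrelevant (suc f) (suc g) (suc x) (s≤s x≤f) (s≤s x≤g) = begin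
  parityFuel (suc f) (suc x)                       ≡⟨ parityFuel-step f x ⟩
  oddB (suc x % 2) xor parityFuel f (suc x / 2)    ≡⟨ cong (oddB (suc x % 2) xor_) same ⟩
  oddB (suc x % 2) xor parityFuel g (suc x / 2)    ≡⟨ parityFuel-step g x ⟨
  parityFuel (suc g) (suc x)                       ∎
  where
  open ≡-Reasoning
  same : parityFuel f (suc x / 2) ≡ parityFuel g (suc x / 2)
  same = parityFuel-irrelevant f g (suc x / 2)
           (≤-trans (half≤pred x) x≤f) (≤-trans (half≤pred x) x≤g)

τ-halve : ∀ n → τ n ≡ oddB (n % 2) xor τ (n / 2)
τ-halve zero    = refl
τ-halve (suc x) = trans (parityFuel-step x x)
  (cong (oddB (suc x % 2) xor_)
        (parityFuel-irrelevant x (suc x / 2) (suc x / 2) (half≤pred x) ≤-refl))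

τ-digit : ∀ b q → b < 2 → τ (b + q * 2) ≡ oddB b xor τ q
τ-digit b q b<2 = begin
  τ (b + q * 2)                                    ≡⟨ τ-halve (b + q * 2) ⟩
  oddB ((b + q * 2) % 2) xor τ ((b + q * 2) / 2)   ≡⟨ cong₂ (λ x y → oddB x xor τ y) last rest ⟩
  oddB b xor τ q                                   ∎
  where
  open ≡-Reasoning
  b%2≡b : b % 2 ≡ b
  b%2≡b = m<n⇒m%n≡m b<2
  last : (b + q * 2) % 2 ≡ b
  last = trans ([m+kn]%n≡m%n b q 2) b%2≡b
  noCarry : b % 2 + q * 2 % 2 < 2
  noCarry = subst (_< 2) (sym (trans (cong₂ _+_ b%2≡b (m*n%n≡0 q 2)) (+-identityʳ b))) b<2
  rest : (b + q * 2) / 2 ≡ q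
  rest = trans (+-distrib-/ b (q * 2) noCarry) (cong₂ _+_ (m<n⇒m/n≡0 b<2) (m*n/n≡m q 2))

-- Concatenation: for r < 2^l, the binary expansion of 2^l·n + r is that of n
-- followed by the l digits of r, so the digit parities add up.
τ-concat : ∀ l n r → r < 2 ^ l → τ (2 ^ l * n + r) ≡ τ n xor τ r
τ-concat zero    n zero    _          = begin
  τ (1 * n + 0)  ≡⟨ cong τ (trans (+-identityʳ _) (*-identityˡ n)) ⟩
  τ n            ≡⟨ xor-identityʳ (τ n) ⟨
  τ n xor false  ∎
  where open ≡-Reasoning
τ-concat zero    n (suc r) (s≤s ())
τ-concat (suc l) n r r<2L = begin
  τ (2 ^ suc l * n + r)                    ≡⟨ cong τ split ⟩
  τ (b + (2 ^ l * n + q) * 2)              ≡⟨ τ-digit b (2 ^ l * n + q) (m%n<n r 2) ⟩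
  oddB b xor τ (2 ^ l * n + q)             ≡⟨ cong (oddB b xor_) (τ-concat l n q q<L) ⟩
  oddB b xor (τ n xor τ q)                 ≡⟨ swap (oddB b) (τ n) (τ q) ⟩
  τ n xor (oddB b xor τ q)                 ≡⟨ cong (τ n xor_) (τ-halve r) ⟨
  τ n xor τ r                              ∎
  where
  open ≡-Reasoning
  b q : ℕ
  b = r % 2
  q = r / 2
  q<L : q < 2 ^ l
  q<L = m<n*o⇒m/o<n (subst (r <_) (*-comm 2 (2 ^ l)) r<2L)
  regroup : ∀ L n b q → 2 * L * n + (b + q * 2) ≡ b + (L * n + q) * 2
  regroup = solve-∀
  split : 2 ^ suc l * n + r ≡ b + (2 ^ l * n + q) * 2
  split = trans (cong (2 ^ suc l * n +_) (m≡m%n+[m/n]*n r 2)) (regroup (2 ^ l) n b q)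
  swap : ∀ x y z → x xor (y xor z) ≡ y xor (x xor z)
  swap x y z = trans (sym (xor-assoc x y z))
                 (trans (cong (_xor z) (xor-comm x y)) (xor-assoc y x z))

τ-shiftBlock : ∀ l m c ρ → τ c ≡ τ (c + m) → ρ < 2 ^ l →
               τ (2 ^ l * c + ρ) ≡ τ (2 ^ l * c + ρ + 2 ^ l * m)
τ-shiftBlock l m c ρ τc≡ ρ<L = begin
  τ (L * c + ρ)            ≡⟨ τ-concat l c ρ ρ<L ⟩
  τ c xor τ ρ              ≡⟨ cong (_xor τ ρ) τc≡ ⟩
  τ (c + m) xor τ ρ        ≡⟨ τ-concat l (c + m) ρ ρ<L ⟨
  τ (L * (c + m) + ρ)      ≡⟨ cong τ (regroup L c m ρ) ⟩
  τ (L * c + ρ + L * m)    ∎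
  where
  open ≡-Reasoning
  L : ℕ
  L = 2 ^ l
  regroup : ∀ L c m ρ → L * (c + m) + ρ ≡ L * c + ρ + L * m
  regroup = solve-∀

τ-shiftWindow : ∀ l m c ρ → τ c ≡ τ (c + m) → τ (suc c) ≡ τ (suc c + m) →
                ρ < 2 ^ l + 2 ^ l → τ (2 ^ l * c + ρ) ≡ τ (2 ^ l * c + ρ + 2 ^ l * m)
τ-shiftWindow l m c ρ τc≡ τc+1≡ ρ<2L with ρ <? 2 ^ l
... | yes ρ<L = τ-shiftBlock l m c ρ τc≡ ρ<L
... | no ρ≮L  = subst (λ y → τ y ≡ τ (y + L * m)) inNextBlock
                  (τ-shiftBlock l m (suc c) ρ' τc+1≡ ρ'<L)
  where
  L : ℕ
  L = 2 ^ l
  ρ' : ℕ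
  ρ' = ρ ∸ L
  L+ρ'≡ρ : L + ρ' ≡ ρ
  L+ρ'≡ρ = m+[n∸m]≡n (≮⇒≥ ρ≮L)
  ρ'<L : ρ' < L
  ρ'<L = +-cancelˡ-< L ρ' L (subst (_< L + L) (sym L+ρ'≡ρ) ρ<2L)
  regroup : ∀ L c ρ' → L * suc c + ρ' ≡ L * c + (L + ρ')
  regroup = solve-∀
  inNextBlock : L * suc c + ρ' ≡ L * c + ρ
  inNextBlock = trans (regroup L c ρ') (cong (L * c +_) L+ρ'≡ρ)

n≤2*⌈n/2⌉ : ∀ n → n ≤ 2 * ⌈ n /2⌉
n≤2*⌈n/2⌉ n = begin
  n                      ≡⟨ ⌊n/2⌋+⌈n/2⌉≡n n ⟨
  ⌊ n /2⌋ + ⌈ n /2⌉      ≤⟨ +-monoˡ-≤ ⌈ n /2⌉ (⌊n/2⌋≤⌈n/2⌉ n) ⟩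
  ⌈ n /2⌉ + ⌈ n /2⌉      ≡⟨ cong (⌈ n /2⌉ +_) (+-identityʳ ⌈ n /2⌉) ⟨
  2 * ⌈ n /2⌉            ∎
  where open ≤-Reasoning

-- n ≤ 2^⌈log₂ n⌉, by the recursion ⌈log₂ (n+2)⌉ = 1 + ⌈log₂ ⌈(n+2)/2⌉⌉; it is
-- stated for an arbitrary accessibility proof, on which ⌈log2⌉ recurses.
≤2^⌈log2⌉ : ∀ n (rec : Acc _<_ n) → n ≤ 2 ^ ⌈log2⌉ n rec
≤2^⌈log2⌉ zero          _        = z≤n
≤2^⌈log2⌉ (suc zero)    _        = s≤s z≤n
≤2^⌈log2⌉ (suc (suc n)) (acc rs) =
  ≤-trans (n≤2*⌈n/2⌉ (suc (suc n))) (*-monoʳ-≤ 2 (≤2^⌈log2⌉ (suc ⌈ n /2⌉) _))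

≤2^⌈log₂⌉ : ∀ n → n ≤ 2 ^ ⌈log₂ n ⌉
≤2^⌈log₂⌉ n = ≤2^⌈log2⌉ n _

reachAbove : ∀ x y m → 1 ≤ m → ∃[ a ] (y ≤ x + a * m × x + a * m < x + y + m)
reachAbove x zero    m 1≤m = 0 , z≤n , m<m+n (x + 0) 1≤m
reachAbove x (suc y) m 1≤m with reachAbove x y m 1≤m
... | a , y≤ , below with suc y ≤? x + a * m
...   | yes y<        = a , y< , <-trans below (+-monoˡ-< m (+-monoʳ-< x ≤-refl))
...   | no y≮         = suc a , reached , bound
  where
  atY : x + a * m ≡ y
  atY = ≤-antisym (≤-pred (≰⇒> y≮)) y≤
  step : x + suc a * m ≡ y + m
  step = trans (regroup x a m) (cong (_+ m) atY)
    where
    regroup : ∀ x a m → x + suc a * m ≡ x + a * m + m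
    regroup = solve-∀
  reached : suc y ≤ x + suc a * m
  reached = subst (suc y ≤_) (sym step) (subst (_≤ y + m) (+-comm y 1) (+-monoʳ-≤ y 1≤m))
  bound : x + suc a * m < x + suc y + m
  bound = subst (_< x + suc y + m) (sym step) (+-monoˡ-< m (m≤n+m (suc y) x))

leastBelow : {P : ℕ → Set} → (∀ n → Dec (P n)) → ∀ v → ∃[ n ] (n < v × P n) →
             ∃[ k ] (k < v × P k × (∀ k′ → k′ < k → ¬ P k′))
leastBelow P? (suc v) (n , n<1+v , Pn) with anyUpTo? P? v
... | yes witness = let k , k<v , Pk , least = leastBelow P? v witness
                    in  k , m<n⇒m<1+n k<v , Pk , least
... | no none     = n , n<1+v , Pn ,
                    λ k′ k′<n Pk′ → none (k′ , <-≤-trans k′<n (≤-pred n<1+v) , Pk′)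

blocksEqual? : ∀ j m a b → Dec (BlocksEqual j m a b)
blocksEqual? j m a b =
  map′ (λ eq r r<m → eq {r} r<m) (λ eq {r} r<m → eq r r<m)
       (allUpTo? (λ r → t (j + a * m + r + 1) Bool.≟ t (j + b * m + r + 1)) m)

isAntiPower? : ∀ j m k → Dec (IsAntiPower j m k)
isAntiPower? j m k =
  map′ (λ ap a b a<b b<k → ap {b} b<k {a} a<b) (λ ap {b} b<k {a} a<b → ap a b a<b b<k)
       (allUpTo? (λ b → allUpTo? (λ a → ¬? (blocksEqual? j m a b)) b) k)

-- A j-fix that is not an anti-power bounds 𝔎_j(m): the least non-anti-power
-- length exists and is positive, since the empty word is trivially an anti-power.
𝔎-exists : ∀ j m n → ¬ IsAntiPower j m n → ∃[ k ] (k ≤ n × IsK j m k)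
𝔎-exists j m n notAP with leastBelow (λ k → ¬? (isAntiPower? j m k)) (suc n) (n , ≤-refl , notAP)
... | zero  , _     , notAP₀ , _     = ⊥-elim (notAP₀ (λ _ _ _ ()))
... | suc k , k<1+n , notAPk , least =
  suc k , ≤-pred k<1+n , s≤s z≤n , notAPk ,
  λ k′ _ k′<k → decidable-stable (isAntiPower? j m k′) (least k′ k′<k)

blocksRepeat : ∀ l j m c a → τ c ≡ τ (c + m) → τ (suc c) ≡ τ (suc c + m) →
               2 ^ l * c ≤ j + a * m → j + a * m + m ≤ 2 ^ l * c + (2 ^ l + 2 ^ l) →
               BlocksEqual j m a (a + 2 ^ l)
blocksRepeat l j m c a τc≡ τc+1≡ lo hi r r<m = begin
  t (x + 1)                  ≡⟨ τ-shifted x ⟩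
  τ x                        ≡⟨ cong τ x≡ ⟨
  τ (L * c + ρ)              ≡⟨ τ-shiftWindow l m c ρ τc≡ τc+1≡ ρ<2L ⟩
  τ (L * c + ρ + L * m)      ≡⟨ cong (λ y → τ (y + L * m)) x≡ ⟩
  τ (x + L * m)              ≡⟨ cong τ (regroup j a m r L) ⟩
  τ (j + (a + L) * m + r)    ≡⟨ τ-shifted (j + (a + L) * m + r) ⟨
  t (j + (a + L) * m + r + 1) ∎
  where
  open ≡-Reasoning
  L : ℕ
  L = 2 ^ l
  x ρ : ℕ
  x = j + a * m + r
  ρ = x ∸ L * c
  x≡ : L * c + ρ ≡ x
  x≡ = m+[n∸m]≡n (≤-trans lo (m≤m+n (j + a * m) r))
  ρ<2L : ρ < L + L
  ρ<2L = +-cancelˡ-< (L * c) ρ (L + L)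
           (subst (_< L * c + (L + L)) (sym x≡) (<-≤-trans (+-monoʳ-< (j + a * m) r<m) hi))
  regroup : ∀ j a m r L → j + a * m + r + L * m ≡ j + (a + L) * m + r
  regroup = solve-∀

blockFitsWindow : ∀ j m L c a → m + j ≤ L → j + a * m < j + L * c + m →
                  j + a * m + m < L * c + (L + L)
blockFitsWindow j m L c a m+j≤L below = begin-strict
  j + a * m + m            <⟨ +-monoˡ-< m below ⟩
  j + L * c + m + m        ≡⟨ regroup j L c m ⟩
  L * c + ((m + j) + m)    ≤⟨ +-monoʳ-≤ (L * c) (+-mono-≤ m+j≤L (≤-trans (m≤m+n m j) m+j≤L)) ⟩
  L * c + (L + L)          ∎
  where
  open ≤-Reasoning
  regroup : ∀ j L c m → j + L * c + m + m ≡ L * c + ((m + j) + m)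
  regroup = solve-∀

τ-agree : ∀ n m → t (n + 1) ≡ t (m + n + 1) → τ n ≡ τ (n + m)
τ-agree n m e = begin
  τ n              ≡⟨ τ-shifted n ⟨
  t (n + 1)        ≡⟨ e ⟩
  t (m + n + 1)    ≡⟨ cong (λ y → t (y + 1)) (+-comm m n) ⟩
  t (n + m + 1)    ≡⟨ τ-shifted (n + m) ⟩
  τ (n + m)        ∎
  where open ≡-Reasoning

-- The theorem for any l with m + j ≤ 2^l, in terms of the 0-indexed word τ and
-- c = s - 1: the window [2^l·c, 2^l·(c+2)) contains a block a of the j-fix,
-- block a + 2^l repeats it, and so 𝔎_j(m) ≤ a + 2^l + 1.
𝔎-bound : ∀ l j m c → 1 ≤ m → m + j ≤ 2 ^ l →
          τ c ≡ τ (c + m) → τ (suc c) ≡ τ (suc c + m) →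
          ∃[ k ] (IsK j m k × k * m + j < 2 ^ l * m + 2 ^ l * (suc c + 1))
𝔎-bound l j m c 1≤m m+j≤L τc≡ τc+1≡ =
  let a , lo , below = reachAbove j (L * c) m 1≤m
      fits           = blockFitsWindow j m L c a m+j≤L below
      k , k≤ , isK   = 𝔎-exists j m (suc (a + L)) (repeatedBlocks a lo fits)
  in  k , isK , bound k a k≤ fits
  where
  L : ℕ
  L = 2 ^ l
  repeatedBlocks : ∀ a → L * c ≤ j + a * m → j + a * m + m < L * c + (L + L) →
                   ¬ IsAntiPower j m (suc (a + L))
  repeatedBlocks a lo fits notAP =
    notAP a (a + L) (m<m+n a (≤-trans 1≤m (≤-trans (m≤m+n m j) m+j≤L))) ≤-refl
          (blocksRepeat l j m c a τc≡ τc+1≡ lo (<⇒≤ fits))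
  bound : ∀ k a → k ≤ suc (a + L) → j + a * m + m < L * c + (L + L) →
          k * m + j < L * m + L * (suc c + 1)
  bound k a k≤ fits = begin-strict
    k * m + j                    ≤⟨ +-monoˡ-≤ j (*-monoˡ-≤ m k≤) ⟩
    suc (a + L) * m + j          ≡⟨ regroup₁ a L m j ⟩
    L * m + (j + a * m + m)      <⟨ +-monoʳ-< (L * m) fits ⟩
    L * m + (L * c + (L + L))    ≡⟨ regroup₂ L m c ⟩
    L * m + L * (suc c + 1)      ∎
    where
    open ≤-Reasoning
    regroup₁ : ∀ a L m j → suc (a + L) * m + j ≡ L * m + (j + a * m + m)
    regroup₁ = solve-∀
    regroup₂ : ∀ L m c → L * m + (L * c + (L + L)) ≡ L * m + L * (suc c + 1)
    regroup₂ = solve-∀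

mainTheorem10 : (j m s : ℕ) → 2 ≤ m → 1 ≤ s →
                t s ≡ t (m + s) → t (s + 1) ≡ t (m + s + 1) →
                ∃[ k ] (IsK j m k ×
                  k * m + j < 2 ^ ⌈log₂ (m + j) ⌉ * m + 2 ^ ⌈log₂ (m + j) ⌉ * (s + 1))
mainTheorem10 j m (suc c) 2≤m _ e₁ e₂ =
  𝔎-bound ⌈log₂ (m + j) ⌉ j m c (≤-trans (s≤s z≤n) 2≤m) (≤2^⌈log₂⌉ (m + j))
          (τ-agree c m e₁′) (τ-agree (suc c) m e₂)
  where
  e₁′ : t (c + 1) ≡ t (m + c + 1)
  e₁′ = subst₂ (λ x y → t x ≡ t y) (+-comm 1 c)
          (trans (cong (m +_) (+-comm 1 c)) (sym (+-assoc m c 1))) e₁
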